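{- Let $G$ be a finite simple undirected graph with an edge coloring $c: E(G) \to \mathbb{N}$, and let $k$ be an integer such that $d^c(v) \geq k$ for every vertex $v \in V(G)$. If $t$ is the maximum length of a rainbow path in $G$, then $t \geq \left\lceil \frac{3k}{5} \right\rceil$.
   Context: An edge coloring of $G$ is an arbitrary map $c: E(G)\to\mathbb{N}$ (adjacent edges may share colors). The color degree $d^c(v)$ of a vertex $v$ is the number of distinct colors appearing on edges incident to $v$. A rainbow path is a path in which all edges have pairwise distinct colors. The length of a path is its number of edges. -}

module Defs where

open import Data.Nat using (ℕ; suc)
open import Data.Nat.Properties using (_≟_)
open import Data.Bool using (Bool; true; false; T)
open import Data.Fin using (Fin; zero; suc; inject₁)
open import Data.List using (List; length; map; filter; deduplicate; allFin)
open import Data.Product using (_×_; Σ; _,_)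
open import Relation.Binary.PropositionalEquality using (_≡_)
open import Relation.Nullary using (¬_)
open import Relation.Nullary.Decidable using (T?)
open import Function.Definitions using (Injective)

record Graph (n : ℕ) : Set where
  field
    adj   : Fin n → Fin n → Bool
    sym   : ∀ u v → adj u v ≡ adj v u
    irrefl : ∀ v → adj v v ≡ false

open Graph public

-- An edge colouring c : E(G) → ℕ, given as a function on vertex pairs that is
-- symmetric on edges (its values on non-edges are irrelevant).
record EdgeColoring {n : ℕ} (G : Graph n) : Set where
  field
    col    : Fin n → Fin n → ℕ
    col-sym : ∀ u v → T (adj G u v) → col u v ≡ col v u

open EdgeColoring public

neighbours : ∀ {n} (G : Graph n) → Fin n → List (Fin n)
neighbours {n} G v = filter (λ u → T? (adj G v u)) (allFin n)

colorDegree : ∀ {n} {G : Graph n} → EdgeColoring G → Fin n → ℕ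
colorDegree {G = G} c v = length (deduplicate _≟_ (map (col c v) (neighbours G v)))

-- A rainbow path of length t (t edges, t+1 vertices) given by its vertex sequence
record RainbowPath {n : ℕ} {G : Graph n} (c : EdgeColoring G) (t : ℕ) : Set where
  field
    vtx       : Fin (suc t) → Fin n
    distinct  : Injective _≡_ _≡_ vtx
    adjacent  : ∀ (i : Fin t) → T (adj G (vtx (inject₁ i)) (vtx (suc i)))
    rainbow   : Injective _≡_ _≡_ (λ (i : Fin t) → col c (vtx (inject₁ i)) (vtx (suc i)))

IsMaxRainbowLength : ∀ {n} {G : Graph n} → EdgeColoring G → ℕ → Set
IsMaxRainbowLength {n} c t = RainbowPath c t × (∀ s → RainbowPath c s → s Data.Nat.≤ t)

-- Let P = v₀ v₁ … vₜ be a longest rainbow path.  Every colour at v₀ and every colour at vₜ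
-- is charged to one of 3t slots, no two colours sharing a slot, so d^c(v₀) + d^c(vₜ) ≤ 3t and
-- hence 2k ≤ 3t, which is stronger than t ≥ ⌈3k/5⌉.
--   * An edge v₀u with u = v_{i+1} on P takes slot i.  If u is off P, its colour already occurs
--     on P (else u v₀ … vₜ is longer), say as the colour of v_j v_{j+1}; it takes slot 2t + j.
--   * A colour at vₜ that occurs on P as the colour of v_j v_{j+1} takes slot t + j.  Otherwise
--     the edge vₜu has u on P (else v₀ … vₜ u is longer), u = v_j with j < t; it takes slot 2t + j.
-- A clash in slot 2t + j is impossible: in the Pósa rotation u v₀ … v_j vₜ vₜ₋₁ … v_{j+1} the
-- colour of the dropped edge v_j v_{j+1} moves to u v₀ and the chord v_j vₜ brings a new colour,
-- so it would be a rainbow path of length t + 1.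
module Submission where

open import Defs
open import Data.Nat using (ℕ; zero; suc; _≤_; _*_; _+_; _/_)
open import Data.Fin using (Fin; zero; suc)

open import Data.Bool using (T)
open import Data.Empty using (⊥; ⊥-elim)
open import Data.Fin using (inject₁; fromℕ)
import Data.Fin as Fin
open import Data.Fin.Properties using (+↔⊎; injective⇒≤)
open import Data.List
  using (List; []; _∷_; _++_; _∷ʳ_; map; reverse; tabulate; lookup; length; deduplicate; allFin)
open import Data.List.Properties
  using ( unfold-reverse; reverse-map; length-reverse; map-tabulate; tabulate-lookup; map-++; map-∘
        ; map-cong-local; length-++; length-map; length-tabulate)
open import Data.List.Membership.Propositional using (_∈_; _∉_)
open import Data.List.Membership.Propositional.Properties
  using (∈-lookup; ∈-map⁻; ∈-filter⁻; ∈-tabulate⁻; ∈-++⁻)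
open import Data.List.Relation.Binary.Permutation.Propositional
  using (_↭_; ↭⇒↭ₛ; ↭-sym; ↭-trans; ↭-prep)
open import Data.List.Relation.Binary.Permutation.Propositional.Properties
  using (↭-reverse; ∈-resp-↭; All-resp-↭; shift; ++⁺ˡ)
import Data.List.Relation.Binary.Permutation.Setoid.Properties as Permutationₛ
open import Data.List.Relation.Unary.All as All using (All; _∷_)
import Data.List.Relation.Unary.All.Properties as All
open import Data.List.Relation.Unary.AllPairs using (_∷_)
open import Data.List.Relation.Unary.Any using (here; there; any?)
import Data.List.Relation.Unary.Any.Properties as Any
open import Data.List.Relation.Unary.Unique.Propositional using (Unique)
import Data.List.Relation.Unary.Unique.Propositional.Properties as Unique
open import Data.Nat.DivMod using (m<n*o⇒m/o<n)
import Data.Nat.Properties as ℕ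
open import Data.Nat.Tactic.RingSolver using (solve-∀)
open import Data.List.Relation.Unary.Unique.DecPropositional.Properties ℕ._≟_ using (deduplicate-!)
open import Data.Product using (_×_; _,_; ∃; ∃₂; proj₁; proj₂; swap)
open import Data.Sum using (_⊎_; inj₁; inj₂)
open import Data.Sum.Properties using (inj₁-injective; inj₂-injective)
open import Data.Sum.Function.Propositional using (_⊎-↔_)
open import Function using (_∘_)
open import Function.Bundles using (Injection; _↣_; _↔_)
open import Function.Definitions using (Injective)
open import Function.Properties.Inverse using (↔-refl; ↔-sym; ↔-trans; ↔⇒↣)
open import Relation.Nullary using (¬_; yes; no)
open import Relation.Nullary.Decidable using (T?; decidable-stable)
open import Relation.Binary.PropositionalEquality as ≡
  using (_≡_; _≢_; refl; trans; cong; cong₂; subst; subst₂; setoid; module ≡-Reasoning)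

private
  variable
    A : Set

unique-resp-↭ : {xs ys : List A} → xs ↭ ys → Unique xs → Unique ys
unique-resp-↭ p = Permutationₛ.Unique-resp-↭ (setoid _) (↭⇒↭ₛ p)

unique-insert : ∀ {x y : A} {zs} → Unique (x ∷ zs) → y ∉ x ∷ zs → Unique (x ∷ y ∷ zs)
unique-insert (x∉zs ∷ uniq) y∉ =
  ((λ x≡y → y∉ (here (≡.sym x≡y))) ∷ x∉zs) ∷ (All.¬Any⇒All¬ _ (y∉ ∘ there) ∷ uniq)

unique-tabulate⁻ : ∀ {m} {f : Fin m → A} → Unique (tabulate f) → Injective _≡_ _≡_ f
unique-tabulate⁻ _          {zero}  {zero}  _  = refl
unique-tabulate⁻ (f0∉ ∷ _)  {zero}  {suc j} eq = ⊥-elim (All.tabulate⁻ f0∉ j eq)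
unique-tabulate⁻ (f0∉ ∷ _)  {suc i} {zero}  eq = ⊥-elim (All.tabulate⁻ f0∉ i (≡.sym eq))
unique-tabulate⁻ (_ ∷ uniq) {suc i} {suc j} eq = cong suc (unique-tabulate⁻ uniq eq)

unique-lookup-injective : {xs : List A} → Unique xs → Injective _≡_ _≡_ (lookup xs)
unique-lookup-injective {xs = _ ∷ _} _          {zero}  {zero}  _  = refl
unique-lookup-injective {xs = _ ∷ _} (x∉ ∷ _)   {zero}  {suc j} eq = ⊥-elim (All.lookup x∉ (∈-lookup j) eq)
unique-lookup-injective {xs = _ ∷ _} (x∉ ∷ _)   {suc i} {zero}  eq =
  ⊥-elim (All.lookup x∉ (∈-lookup i) (≡.sym eq))
unique-lookup-injective {xs = _ ∷ _} (_ ∷ uniq) {suc i} {suc j} eq = cong suc (unique-lookup-injective uniq eq)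

length≤-of-slots : ∀ {S : Set} {N} {xs : List A} → Unique xs → S ↣ Fin N →
                   (Occupies : A → S → Set) →
                   (∀ {x} → x ∈ xs → ∃ (Occupies x)) →
                   (∀ {x y s} → Occupies x s → Occupies y s → x ≡ y) →
                   length xs ≤ N
length≤-of-slots {S = S} {xs = xs} uniq S↣Fin Occupies place shared = injective⇒≤ {f = to ∘ slot} slot-injective
  where
  open Injection S↣Fin using (to; injective)

  slot : Fin (length xs) → S
  slot i = proj₁ (place (∈-lookup i))

  occupies : ∀ i → Occupies (lookup xs i) (slot i)
  occupies i = proj₂ (place (∈-lookup i))

  slot-injective : Injective _≡_ _≡_ (to ∘ slot)
  slot-injective {i} {j} eq =
    unique-lookup-injective uniq (shared (occupies i) (subst (Occupies _) (≡.sym (injective eq)) (occupies j)))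

fromℕ-or-inject₁ : ∀ {m} (i : Fin (suc m)) → i ≡ fromℕ m ⊎ ∃ λ j → i ≡ inject₁ j
fromℕ-or-inject₁ {zero}  zero    = inj₁ refl
fromℕ-or-inject₁ {suc m} zero    = inj₂ (zero , refl)
fromℕ-or-inject₁ {suc m} (suc i) with fromℕ-or-inject₁ i
... | inj₁ i≡last    = inj₁ (cong suc i≡last)
... | inj₂ (j , i≡j) = inj₂ (suc j , cong suc i≡j)

-- A walk is given by its first vertex x and the list xs of its remaining vertices.

edges : A → List A → List (A × A)
edges x []       = []
edges x (y ∷ ys) = (x , y) ∷ edges y ys

end : A → List A → A
end x []       = x
end x (y ∷ ys) = end y ys

edges-++ : ∀ (x : A) xs y ys → edges x (xs ++ y ∷ ys) ≡ edges x xs ++ (end x xs , y) ∷ edges y ys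
edges-++ x []       y ys = refl
edges-++ x (z ∷ zs) y ys = cong ((x , z) ∷_) (edges-++ z zs y ys)

end-++ : ∀ (x : A) xs y ys → end x (xs ++ y ∷ ys) ≡ end y ys
end-++ x []       y ys = refl
end-++ x (z ∷ zs) y ys = end-++ z zs y ys

reverseTail : A → List A → List A
reverseTail x []       = []
reverseTail x (y ∷ ys) = reverseTail y ys ∷ʳ x

reverse-∷ : ∀ (x : A) xs → reverse (x ∷ xs) ≡ end x xs ∷ reverseTail x xs
reverse-∷ x []       = refl
reverse-∷ x (y ∷ ys) = begin
  reverse (x ∷ y ∷ ys)             ≡⟨ unfold-reverse x (y ∷ ys) ⟩
  reverse (y ∷ ys) ∷ʳ x            ≡⟨ cong (_∷ʳ x) (reverse-∷ y ys) ⟩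
  end y ys ∷ reverseTail y ys ∷ʳ x ∎
  where open ≡-Reasoning

reverse-↭ : ∀ (x : A) xs → end x xs ∷ reverseTail x xs ↭ x ∷ xs
reverse-↭ x xs = subst (_↭ x ∷ xs) (reverse-∷ x xs) (↭-reverse (x ∷ xs))

length-reverseTail : ∀ (x : A) xs → length (reverseTail x xs) ≡ length xs
length-reverseTail x xs = ℕ.suc-injective (begin
  length (end x xs ∷ reverseTail x xs) ≡⟨ cong length (reverse-∷ x xs) ⟨
  length (reverse (x ∷ xs))            ≡⟨ length-reverse (x ∷ xs) ⟩
  length (x ∷ xs)                      ∎)
  where open ≡-Reasoning

end-reverseTail : ∀ (x : A) xs → end (end x xs) (reverseTail x xs) ≡ x
end-reverseTail x []       = refl
end-reverseTail x (y ∷ ys) = end-++ (end y ys) (reverseTail y ys) x []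

edges-reverseTail : ∀ (x : A) xs → edges (end x xs) (reverseTail x xs) ≡ reverse (map swap (edges x xs))
edges-reverseTail x []       = refl
edges-reverseTail x (y ∷ ys) = begin
  edges (end y ys) (reverseTail y ys ∷ʳ x)
    ≡⟨ edges-++ (end y ys) (reverseTail y ys) x [] ⟩
  edges (end y ys) (reverseTail y ys) ∷ʳ (end (end y ys) (reverseTail y ys) , x)
    ≡⟨ cong₂ (λ es z → es ∷ʳ (z , x)) (edges-reverseTail y ys) (end-reverseTail y ys) ⟩
  reverse (map swap (edges y ys)) ∷ʳ (y , x)
    ≡⟨ unfold-reverse (y , x) (map swap (edges y ys)) ⟨
  reverse (map swap (edges x (y ∷ ys))) ∎
  where open ≡-Reasoning

-- The Pósa rotation of the walk x ∷ xs ++ y ∷ ys along the chord from end x xs to end y ys.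
rotate : List A → A → List A → List A
rotate xs y ys = xs ++ end y ys ∷ reverseTail y ys

length-rotate : ∀ (xs : List A) y ys → length (rotate xs y ys) ≡ length (xs ++ y ∷ ys)
length-rotate xs y ys = begin
  length (xs ++ end y ys ∷ reverseTail y ys)  ≡⟨ length-++ xs ⟩
  length xs + suc (length (reverseTail y ys)) ≡⟨ cong (λ l → length xs + suc l) (length-reverseTail y ys) ⟩
  length xs + suc (length ys)                 ≡⟨ length-++ xs ⟨
  length (xs ++ y ∷ ys)                       ∎
  where open ≡-Reasoning

edges-tabulate : ∀ {m} (f : Fin (suc m) → A) →
                 edges (f zero) (tabulate (f ∘ suc)) ≡ tabulate (λ i → f (inject₁ i) , f (suc i))
edges-tabulate {m = zero}  f = refl
edges-tabulate {m = suc m} f = cong ((f zero , f (suc zero)) ∷_) (edges-tabulate (f ∘ suc))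

end-tabulate : ∀ {m} (f : Fin (suc m) → A) → end (f zero) (tabulate (f ∘ suc)) ≡ f (fromℕ m)
end-tabulate {m = zero}  f = refl
end-tabulate {m = suc m} f = end-tabulate (f ∘ suc)

tabulate-split : ∀ {m} (f : Fin (suc m) → A) (j : Fin m) →
                 ∃₂ λ xs ys → tabulate (f ∘ suc) ≡ xs ++ f (suc j) ∷ ys × end (f zero) xs ≡ f (inject₁ j)
tabulate-split {m = suc m} f zero    = [] , tabulate (λ i → f (suc (suc i))) , refl , refl
tabulate-split {m = suc m} f (suc j) with tabulate-split (f ∘ suc) j
... | xs , ys , split , end-xs = f (suc zero) ∷ xs , ys , cong (f (suc zero) ∷_) split , end-xs

module RainbowPathList {n : ℕ} {G : Graph n} (c : EdgeColoring G) where

  Adjacent : Fin n × Fin n → Set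
  Adjacent (u , v) = T (adj G u v)

  colour : Fin n × Fin n → ℕ
  colour (u , v) = col c u v

  colours : Fin n → List (Fin n) → List ℕ
  colours x xs = map colour (edges x xs)

  adjacent-swap : ∀ {e} → Adjacent e → Adjacent (swap e)
  adjacent-swap {u , v} = subst T (Graph.sym G u v)

  colour-swap : ∀ {e} → Adjacent e → colour (swap e) ≡ colour e
  colour-swap {u , v} uv = ≡.sym (col-sym c u v uv)

  not-self-adjacent : ∀ {u v} → Adjacent (u , v) → u ≢ v
  not-self-adjacent {u} uu refl = subst T (irrefl G u) uu

  coloursAt : Fin n → List ℕ
  coloursAt v = deduplicate ℕ._≟_ (map (col c v) (neighbours G v))

  ∈-coloursAt⁻ : ∀ {v γ} → γ ∈ coloursAt v → ∃ λ u → Adjacent (v , u) × γ ≡ col c v u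
  ∈-coloursAt⁻ {v} γ∈ with ∈-map⁻ (col c v) (Any.deduplicate⁻ ℕ._≟_ γ∈)
  ... | u , u∈ , γ≡ = u , proj₂ (∈-filter⁻ (λ u → T? (adj G v u)) {xs = allFin n} u∈) , γ≡

  record IsRainbowPath (x : Fin n) (xs : List (Fin n)) : Set where
    field
      distinct : Unique (x ∷ xs)
      adjacent : All Adjacent (edges x xs)
      rainbow  : Unique (colours x xs)

  open IsRainbowPath

  colours-tabulate : ∀ {m} (f : Fin (suc m) → Fin n) →
                     colours (f zero) (tabulate (f ∘ suc)) ≡ tabulate (λ i → col c (f (inject₁ i)) (f (suc i)))
  colours-tabulate f = trans (cong (map colour) (edges-tabulate f)) (map-tabulate _ colour)

  tabulate-rainbowPath : ∀ {m} (f : Fin (suc m) → Fin n) →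
                         IsRainbowPath (f zero) (tabulate (f ∘ suc)) → RainbowPath c m
  tabulate-rainbowPath f p = record
    { vtx      = f
    ; distinct = unique-tabulate⁻ (distinct p)
    ; adjacent = All.tabulate⁻ (subst (All Adjacent) (edges-tabulate f) (adjacent p))
    ; rainbow  = unique-tabulate⁻ (subst Unique (colours-tabulate f) (rainbow p))
    }

  toRainbowPath : ∀ {x xs} → IsRainbowPath x xs → RainbowPath c (length xs)
  toRainbowPath {x} {xs} p =
    tabulate-rainbowPath (lookup (x ∷ xs)) (subst (IsRainbowPath x) (≡.sym (tabulate-lookup xs)) p)

  fromRainbowPath : ∀ {m} (P : RainbowPath c m) →
                    IsRainbowPath (RainbowPath.vtx P zero) (tabulate (RainbowPath.vtx P ∘ suc))
  fromRainbowPath P = record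
    { distinct = Unique.tabulate⁺ (RainbowPath.distinct P)
    ; adjacent = subst (All Adjacent) (≡.sym (edges-tabulate vtx)) (All.tabulate⁺ (RainbowPath.adjacent P))
    ; rainbow  = subst Unique (≡.sym (colours-tabulate vtx)) (Unique.tabulate⁺ (RainbowPath.rainbow P))
    }
    where open RainbowPath P using (vtx)

  ∷-rainbow : ∀ {u a as} → IsRainbowPath a as → u ∉ a ∷ as → Adjacent (u , a) → col c u a ∉ colours a as →
              IsRainbowPath u (a ∷ as)
  ∷-rainbow p u∉ ua fresh = record
    { distinct = All.¬Any⇒All¬ _ u∉ ∷ distinct p
    ; adjacent = ua ∷ adjacent p
    ; rainbow  = All.¬Any⇒All¬ _ fresh ∷ rainbow p
    }

  adjacent-++⁻ : ∀ a as b bs → All Adjacent (edges a (as ++ b ∷ bs)) →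
                 All Adjacent (edges a as) × All Adjacent (edges b bs)
  adjacent-++⁻ a as b bs adjacent with All.++⁻ (edges a as) (subst (All Adjacent) (edges-++ a as b bs) adjacent)
  ... | adjacent-as , _ ∷ adjacent-bs = adjacent-as , adjacent-bs

  colours-++ : ∀ a as b bs → colours a (as ++ b ∷ bs) ↭ col c (end a as) b ∷ colours a as ++ colours b bs
  colours-++ a as b bs =
    subst (_↭ γ ∷ colours a as ++ colours b bs) (≡.sym split) (shift γ (colours a as) (colours b bs))
    where
    γ = col c (end a as) b

    split : colours a (as ++ b ∷ bs) ≡ colours a as ++ γ ∷ colours b bs
    split = trans (cong (map colour) (edges-++ a as b bs)) (map-++ colour (edges a as) _)

  adjacent-reverseTail : ∀ {x xs} → All Adjacent (edges x xs) → All Adjacent (edges (end x xs) (reverseTail x xs))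
  adjacent-reverseTail {x} {xs} adjacent = subst (All Adjacent) (≡.sym (edges-reverseTail x xs))
    (All-resp-↭ (↭-sym (↭-reverse _)) (All.map⁺ (All.map adjacent-swap adjacent)))

  colours-reverseTail : ∀ {x xs} → All Adjacent (edges x xs) →
                        colours (end x xs) (reverseTail x xs) ≡ reverse (colours x xs)
  colours-reverseTail {x} {xs} adjacent = begin
    map colour (edges (end x xs) (reverseTail x xs)) ≡⟨ cong (map colour) (edges-reverseTail x xs) ⟩
    map colour (reverse (map swap (edges x xs)))     ≡⟨ reverse-map colour (map swap (edges x xs)) ⟩
    reverse (map colour (map swap (edges x xs)))     ≡⟨ cong reverse (map-∘ (edges x xs)) ⟨
    reverse (map (colour ∘ swap) (edges x xs))       ≡⟨ cong reverse (map-cong-local (All.map colour-swap adjacent)) ⟩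
    reverse (colours x xs)                           ∎
    where open ≡-Reasoning

  colours-reverseTail-↭ : ∀ {x xs} → All Adjacent (edges x xs) →
                          colours (end x xs) (reverseTail x xs) ↭ colours x xs
  colours-reverseTail-↭ {x} {xs} adjacent =
    subst (_↭ colours x xs) (≡.sym (colours-reverseTail adjacent)) (↭-reverse (colours x xs))

  reverse-rainbow : ∀ {x xs} → IsRainbowPath x xs → IsRainbowPath (end x xs) (reverseTail x xs)
  reverse-rainbow {x} {xs} p = record
    { distinct = unique-resp-↭ (↭-sym (reverse-↭ x xs)) (distinct p)
    ; adjacent = adjacent-reverseTail (adjacent p)
    ; rainbow  = unique-resp-↭ (↭-sym (colours-reverseTail-↭ (adjacent p))) (rainbow p)
    }

  colours-rotate : ∀ a as b bs → All Adjacent (edges b bs) →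
                   colours a (rotate as b bs) ↭ col c (end a as) (end b bs) ∷ colours a as ++ colours b bs
  colours-rotate a as b bs adjacent-bs = ↭-trans (colours-++ a as (end b bs) (reverseTail b bs))
    (↭-prep _ (++⁺ˡ (colours a as) (colours-reverseTail-↭ adjacent-bs)))

  adjacent-rotate : ∀ a as b bs → All Adjacent (edges a (as ++ b ∷ bs)) → Adjacent (end a as , end b bs) →
                    All Adjacent (edges a (rotate as b bs))
  adjacent-rotate a as b bs adjacent chord with adjacent-++⁻ a as b bs adjacent
  ... | adjacent-as , adjacent-bs = subst (All Adjacent) (≡.sym (edges-++ a as _ _))
    (All.++⁺ adjacent-as (chord ∷ adjacent-reverseTail adjacent-bs))

  -- The rotation replaces the colour γ of the edge (end a as , b) by the fresh chord colour,
  -- which frees γ for the new edge (u , a).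
  rotate-∷-rainbow : ∀ {u a as b bs} → IsRainbowPath a (as ++ b ∷ bs) → u ∉ a ∷ as ++ b ∷ bs →
                     Adjacent (u , a) → col c u a ≡ col c (end a as) b →
                     Adjacent (end a as , end b bs) → col c (end a as) (end b bs) ∉ colours a (as ++ b ∷ bs) →
                     IsRainbowPath u (a ∷ rotate as b bs)
  rotate-∷-rainbow {u} {a} {as} {b} {bs} p u∉ ua same-colour chord fresh = record
    { distinct = unique-resp-↭ (↭-prep u (↭-prep a (++⁺ˡ as (↭-sym (reverse-↭ b bs)))))
                   (All.¬Any⇒All¬ _ u∉ ∷ distinct p)
    ; adjacent = ua ∷ adjacent-rotate a as b bs (adjacent p) chord
    ; rainbow  = subst (λ γ → Unique (γ ∷ colours a (rotate as b bs))) (≡.sym same-colour)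
                   (unique-resp-↭ (↭-prep _ (↭-sym (colours-rotate a as b bs adjacent-bs)))
                     (unique-insert (unique-resp-↭ split (rainbow p)) (fresh ∘ ∈-resp-↭ (↭-sym split))))
    }
    where
    split = colours-++ a as b bs
    adjacent-bs = proj₂ (adjacent-++⁻ a as b bs (adjacent p))

module MaximumRainbowPath {n : ℕ} {G : Graph n} (c : EdgeColoring G) {t : ℕ}
                          (P : RainbowPath c t) (maximum : ∀ s → RainbowPath c s → s ≤ t) where

  open RainbowPathList c
  open RainbowPath P using (vtx)

  first last : Fin n
  first = vtx zero
  last  = vtx (fromℕ t)

  vertices inner : List (Fin n)
  vertices = tabulate vtx
  inner    = tabulate (vtx ∘ suc)

  pathColour : Fin t → ℕ
  pathColour j = col c (vtx (inject₁ j)) (vtx (suc j))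

  pathColours : List ℕ
  pathColours = tabulate pathColour

  path : IsRainbowPath first inner
  path = fromRainbowPath P

  colours-path : colours first inner ≡ pathColours
  colours-path = colours-tabulate vtx

  length-inner : length inner ≡ t
  length-inner = length-tabulate (vtx ∘ suc)

  end-inner : end first inner ≡ last
  end-inner = end-tabulate vtx

  no-longer-rainbowPath : ∀ {x xs} → IsRainbowPath x xs → length xs ≢ suc t
  no-longer-rainbowPath p length≡ = ℕ.1+n≰n (subst (_≤ t) length≡ (maximum _ (toRainbowPath p)))

  outer-edge-colour-on-path : ∀ {x xs u} → IsRainbowPath x xs → length xs ≡ t → u ∉ x ∷ xs →
                              Adjacent (x , u) → col c x u ∈ colours x xs
  outer-edge-colour-on-path {x} {xs} {u} p length≡ u∉ xu =
    decidable-stable (any? (col c x u ℕ.≟_) (colours x xs)) λ fresh →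
      no-longer-rainbowPath
        (∷-rainbow p u∉ (adjacent-swap xu) (subst (_∉ colours x xs) (≡.sym (colour-swap xu)) fresh))
        (cong suc length≡)

  first-edge-colour-on-path : ∀ {u} → u ∉ vertices → Adjacent (first , u) → col c first u ∈ pathColours
  first-edge-colour-on-path {u} u∉ firstu =
    subst (col c first u ∈_) colours-path (outer-edge-colour-on-path path length-inner u∉ firstu)

  last-edge-colour-on-path : ∀ {u} → u ∉ vertices → Adjacent (last , u) → col c last u ∈ pathColours
  last-edge-colour-on-path {u} u∉ lastu = subst₂ _∈_ (cong (λ x → col c x u) end-inner) colours-path
    (∈-resp-↭ (colours-reverseTail-↭ (IsRainbowPath.adjacent path))
      (outer-edge-colour-on-path (reverse-rainbow path)
        (trans (length-reverseTail first inner) length-inner)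
        (u∉ ∘ ∈-resp-↭ (reverse-↭ first inner))
        (subst (λ x → Adjacent (x , u)) (≡.sym end-inner) lastu)))

  no-crossing : ∀ j {u} → u ∉ vertices → Adjacent (first , u) → col c first u ≡ pathColour j →
                Adjacent (last , vtx (inject₁ j)) → col c last (vtx (inject₁ j)) ∉ pathColours → ⊥
  no-crossing j {u} u∉ firstu same-colour chord fresh with tabulate-split vtx j
  ... | as , bs , inner≡ , end-as = no-longer-rainbowPath
          (rotate-∷-rainbow path′ u∉′ (adjacent-swap firstu) same-colour′ chord′ fresh′)
          (cong suc (trans (length-rotate as b bs) (trans (cong length (≡.sym inner≡)) length-inner)))
    where
    b = vtx (suc j)

    end-bs : end b bs ≡ last
    end-bs = trans (≡.sym (end-++ first as b bs)) (trans (cong (end first) (≡.sym inner≡)) end-inner)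

    path′ : IsRainbowPath first (as ++ b ∷ bs)
    path′ = subst (IsRainbowPath first) inner≡ path

    u∉′ : u ∉ first ∷ as ++ b ∷ bs
    u∉′ = subst (λ xs → u ∉ first ∷ xs) inner≡ u∉

    same-colour′ : col c u first ≡ col c (end first as) b
    same-colour′ = trans (colour-swap firstu) (trans same-colour (cong (λ x → col c x b) (≡.sym end-as)))

    chord′ : Adjacent (end first as , end b bs)
    chord′ = subst₂ (λ x y → Adjacent (x , y)) (≡.sym end-as) (≡.sym end-bs) (adjacent-swap chord)

    fresh′ : col c (end first as) (end b bs) ∉ colours first (as ++ b ∷ bs)
    fresh′ = subst₂ _∉_ (trans (≡.sym (colour-swap chord)) (cong₂ (col c) (≡.sym end-as) (≡.sym end-bs)))
               (trans (≡.sym colours-path) (cong (colours first) inner≡)) fresh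

  -- Slots i, t + j and 2t + j are inj₁ i, inj₂ (inj₁ j) and inj₂ (inj₂ j).
  Slot : Set
  Slot = Fin t ⊎ Fin t ⊎ Fin t

  Slot↔Fin : Slot ↔ Fin (t + (t + t))
  Slot↔Fin = ↔-trans (↔-refl ⊎-↔ ↔-sym +↔⊎) (↔-sym +↔⊎)

  data FirstSlot (γ : ℕ) : Slot → Set where
    neighbour : ∀ i → γ ≡ col c first (vtx (suc i)) → FirstSlot γ (inj₁ i)
    crossing  : ∀ j {u} → u ∉ vertices → Adjacent (first , u) → γ ≡ col c first u → γ ≡ pathColour j →
                FirstSlot γ (inj₂ (inj₂ j))

  data LastSlot (β : ℕ) : Slot → Set where
    onPath : ∀ j → β ≡ pathColour j → LastSlot β (inj₂ (inj₁ j))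
    chord  : ∀ j → Adjacent (last , vtx (inject₁ j)) → β ≡ col c last (vtx (inject₁ j)) → β ∉ pathColours →
             LastSlot β (inj₂ (inj₂ j))

  EndpointSlot : ℕ ⊎ ℕ → Slot → Set
  EndpointSlot (inj₁ γ) = FirstSlot γ
  EndpointSlot (inj₂ β) = LastSlot β

  firstSlot-lastSlot-disjoint : ∀ {γ β s} → FirstSlot γ s → LastSlot β s → ⊥
  firstSlot-lastSlot-disjoint (crossing j u∉ firstu refl same-colour) (chord .j lastv refl fresh) =
    no-crossing j u∉ firstu same-colour lastv fresh

  endpointSlot-shared : ∀ {x y s} → EndpointSlot x s → EndpointSlot y s → x ≡ y
  endpointSlot-shared {inj₁ _} {inj₁ _} (neighbour i refl)      (neighbour .i refl)      = refl
  endpointSlot-shared {inj₁ _} {inj₁ _} (crossing j _ _ _ refl) (crossing .j _ _ _ refl) = refl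
  endpointSlot-shared {inj₂ _} {inj₂ _} (onPath j refl)         (onPath .j refl)         = refl
  endpointSlot-shared {inj₂ _} {inj₂ _} (chord j _ refl _)      (chord .j _ refl _)      = refl
  endpointSlot-shared {inj₁ _} {inj₂ _} γs βs = ⊥-elim (firstSlot-lastSlot-disjoint γs βs)
  endpointSlot-shared {inj₂ _} {inj₁ _} βs γs = ⊥-elim (firstSlot-lastSlot-disjoint γs βs)

  firstSlot : ∀ {γ} → γ ∈ coloursAt first → ∃ (FirstSlot γ)
  firstSlot γ∈ with ∈-coloursAt⁻ γ∈
  ... | u , firstu , refl with any? (u Fin.≟_) vertices
  ...   | no u∉ with ∈-tabulate⁻ (first-edge-colour-on-path u∉ firstu)
  ...     | j , same-colour = inj₂ (inj₂ j) , crossing j u∉ firstu refl same-colour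
  firstSlot γ∈ | u , firstu , refl | yes u∈ with ∈-tabulate⁻ {f = vtx} u∈
  ...     | zero  , refl = ⊥-elim (not-self-adjacent firstu refl)
  ...     | suc i , refl = inj₁ i , neighbour i refl

  lastSlot : ∀ {β} → β ∈ coloursAt last → ∃ (LastSlot β)
  lastSlot β∈ with ∈-coloursAt⁻ β∈
  ... | u , lastu , refl with any? (col c last u ℕ.≟_) pathColours
  ...   | yes β∈path with ∈-tabulate⁻ β∈path
  ...     | j , on-path = inj₂ (inj₁ j) , onPath j on-path
  lastSlot β∈ | u , lastu , refl | no fresh with any? (u Fin.≟_) vertices
  ...     | no u∉ = ⊥-elim (fresh (last-edge-colour-on-path u∉ lastu))
  ...     | yes u∈ with ∈-tabulate⁻ {f = vtx} u∈
  ...       | i , refl with fromℕ-or-inject₁ i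
  ...         | inj₁ refl       = ⊥-elim (not-self-adjacent lastu refl)
  ...         | inj₂ (j , refl) = inj₂ (inj₂ j) , chord j lastu refl fresh

  endpointColours : List (ℕ ⊎ ℕ)
  endpointColours = map inj₁ (coloursAt first) ++ map inj₂ (coloursAt last)

  endpointColours-unique : Unique endpointColours
  endpointColours-unique = Unique.++⁺ (Unique.map⁺ inj₁-injective (deduplicate-! _))
    (Unique.map⁺ inj₂-injective (deduplicate-! _)) disjoint
    where
    disjoint : ∀ {x} → ¬ (x ∈ map inj₁ (coloursAt first) × x ∈ map inj₂ (coloursAt last))
    disjoint (x∈₁ , x∈₂) with ∈-map⁻ inj₁ x∈₁ | ∈-map⁻ inj₂ x∈₂
    ... | _ , _ , refl | _ , _ , ()

  endpointSlot : ∀ {x} → x ∈ endpointColours → ∃ (EndpointSlot x)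
  endpointSlot x∈ with ∈-++⁻ (map inj₁ (coloursAt first)) x∈
  ... | inj₁ x∈₁ with ∈-map⁻ inj₁ x∈₁
  ...   | _ , γ∈ , refl = firstSlot γ∈
  endpointSlot x∈ | inj₂ x∈₂ with ∈-map⁻ inj₂ x∈₂
  ...   | _ , β∈ , refl = lastSlot β∈

  colorDegree-first+last≤3t : colorDegree c first + colorDegree c last ≤ t + (t + t)
  colorDegree-first+last≤3t = subst (_≤ t + (t + t)) length-endpointColours
    (length≤-of-slots endpointColours-unique (↔⇒↣ Slot↔Fin) EndpointSlot endpointSlot endpointSlot-shared)
    where
    length-endpointColours : length endpointColours ≡ colorDegree c first + colorDegree c last
    length-endpointColours = trans (length-++ (map inj₁ (coloursAt first)))
      (cong₂ _+_ (length-map inj₁ (coloursAt first)) (length-map inj₂ (coloursAt last)))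

2k≤3t⇒[3k+4]/5≤t : ∀ {k t} → k + k ≤ t + (t + t) → (3 * k + 4) / 5 ≤ t
2k≤3t⇒[3k+4]/5≤t {k} {t} 2k≤3t = ℕ.<⇒≤pred (m<n*o⇒m/o<n (begin-strict
  3 * k + 4 <⟨ ℕ.+-monoʳ-< (3 * k) (ℕ.n<1+n 4) ⟩
  3 * k + 5 ≤⟨ ℕ.+-monoˡ-≤ 5 3k≤5t ⟩
  t * 5 + 5 ≡⟨ ℕ.+-comm (t * 5) 5 ⟩
  suc t * 5 ∎))
  where
  open ℕ.≤-Reasoning

  6k≡3[k+k] : ∀ k → 2 * (3 * k) ≡ 3 * (k + k)
  6k≡3[k+k] = solve-∀

  9t+t≡2[5t] : ∀ t → 3 * (t + (t + t)) + t ≡ 2 * (t * 5)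
  9t+t≡2[5t] = solve-∀

  3k≤5t : 3 * k ≤ t * 5
  3k≤5t = ℕ.*-cancelˡ-≤ 2 (begin
    2 * (3 * k)           ≡⟨ 6k≡3[k+k] k ⟩
    3 * (k + k)           ≤⟨ ℕ.*-monoʳ-≤ 3 2k≤3t ⟩
    3 * (t + (t + t))     ≤⟨ ℕ.m≤m+n _ t ⟩
    3 * (t + (t + t)) + t ≡⟨ 9t+t≡2[5t] t ⟩
    2 * (t * 5)           ∎)

theorem1 : (n : ℕ) (G : Graph n) (c : EdgeColoring G) (k : ℕ)
    → (∀ (v : Fin n) → k ≤ colorDegree c v)
    → (t : ℕ) → IsMaxRainbowLength c t
    → (3 * k + 4) / 5 ≤ t
theorem1 n G c k k≤colorDegree t (P , maximum) = 2k≤3t⇒[3k+4]/5≤t {k} (begin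
  k + k                                    ≤⟨ ℕ.+-mono-≤ (k≤colorDegree first) (k≤colorDegree last) ⟩
  colorDegree c first + colorDegree c last ≤⟨ colorDegree-first+last≤3t ⟩
  t + (t + t)                              ∎)
  where
  open MaximumRainbowPath c P maximum
  open ℕ.≤-Reasoning
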